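{- (1) Let $a,b$ be positive coprime integers and let $\{m\}_n$ be the Euclidean design of $a$ generated by $b$. Then $a=[2^n:m]$ and $b=[2^n:2^n-m]$. In particular, if $(a,b)=(1,1)$ then $(m,n)=(1,1)$. (2) Let $m,n$ be positive integers with $m$ odd, $1\le m\le 2^n-1$ and $(m,n)\ne(1,1)$, and write the binary word $\{m\}_n=1^{k_0}0^{k_1}\cdots 0^{k_{l-2}}1^{k_{l-1}}$ with $l$ odd, $k_0\ge 0$ and $k_i\ge 1$ for $i=1,\dots,l-1$. (i) If $m\equiv 3 \pmod 4$ (i.e. $k_{l-1}\ge 2$), put $t=l$ and $r_i=k_i$ for $i=0,\dots,t-1$. Then the realizing pair $(a,b)$ of $r_0,\dots,r_{t-1}$ exists, and $\{m\}_n$ is the Euclidean design of $a$ generated by $b$. (ii) If $m\equiv 1\pmod 4$ (i.e. $k_{l-1}=1$), put $t=l-1$, $r_i=k_i$ for $i=0,\dots,t-2$, and $r_{t-1}=k_{l-2}+1$. Then the realizing pair $(a,b)$ of $r_0,\dots,r_{t-1}$ exists, and $\{m\}_n$ is the Euclidean design of $a$ generated by $b$.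
   Context: Stern's diatomic integers: for integers $n\ge0$, $0\le m\le 2^n$, define $[2^0:0]=0$, $[2^0:1]=1$, $[2^{n+1}:2m]=[2^n:m]$ ($0\le m\le 2^n$), $[2^{n+1}:2m+1]=[2^n:m]+[2^n:m+1]$ ($0\le m\le 2^n-1$). Designs: for $0\le m\le 2^n-1$, $\{m\}_n$ denotes the binary word $d_1d_2\cdots d_n$ of length $n$ (leading zeros allowed) with $\sum_{i=1}^n 2^{n-i}d_i=m$. We write $x^k$ for $k$ consecutive copies of the letter $x$. Partial quotients: for positive coprime integers $a,b$, run the Euclidean algorithm $c_{i-2}=c_{i-1}r_i+c_i$ ($i=0,1,\dots,t-1$) with $c_{ -2}=a$, $c_{ -1}=b$, integers $0\le c_i<c_{i-1}$, terminating with $c_{t-2}=1$, $c_{t-1}=0$ ($t\ge1$); then $r_0\ge0$, $r_i\ge 1$ ($i\ge1$), and $r_0,\dots,r_{t-1}$ are called the partial quotients of $a$ generated by $b$. For any sequence of integers $r_0\ge0$, $r_1,\dots,r_{t-2}\ge1$, $r_{t-1}\ge2$ there is a unique pair $(a,b)$ of positive coprime integers whose partial quotients are $r_0,\dots,r_{t-1}$; it is called the realizing pair of the sequence. Euclidean design: for positive coprime $a,b$ with partial quotients $r_0,\dots,r_{t-1}$ and $n=\sum r_i$, the Euclidean design of $a$ generated by $b$ is the word $1$ (i.e. $\{1\}_1$) if $(a,b)=(1,1)$; the word $1^{r_0}0^{r_1}1^{r_2}\cdots 0^{r_{t-2}}1^{r_{t-1}}$ if $(a,b)\neq(1,1)$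 and $t$ is odd; and the word $1^{r_0}0^{r_1}\cdots 1^{r_{t-2}}0^{r_{t-1}-1}1$ if $(a,b)\neq(1,1)$ and $t$ is even. Writing it as $\{m\}_n$, $m$ is called the design number. -}

module Defs where

open import Data.Nat using (ℕ; zero; suc; _+_; _*_; _∸_; _^_; _≡ᵇ_)
open import Data.Nat.DivMod using (_/_; _%_)
open import Data.Bool using (Bool; true; false; if_then_else_)
open import Data.List using (List; []; _∷_; _++_; replicate; length; foldl)

-- Stern's diatomic integers: stern n m = [2^n : m]  (meaningful for 0 ≤ m ≤ 2^n;
-- values outside that range are irrelevant junk).
stern : ℕ → ℕ → ℕ
stern zero zero = 0
stern zero (suc zero) = 1
stern zero (suc (suc _)) = 0
stern (suc n) m =
  if m % 2 ≡ᵇ 0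
  then stern n (m / 2)
  else stern n (m / 2) + stern n (suc (m / 2))

-- Binary words: true = letter 1, false = letter 0; d₁ is the head of the list.
-- Value of a word d₁⋯dₙ : Σ 2^{n-i} dᵢ.
val : List Bool → ℕ
val = foldl (λ acc d → 2 * acc + (if d then 1 else 0)) 0

-- {m}_n : the binary word of length n (leading zeros allowed) with value m
-- (for 0 ≤ m ≤ 2^n - 1).
bits : ℕ → ℕ → List Bool
bits zero m = []
bits (suc n) m = bits n (m / 2) ++ ((m % 2 ≡ᵇ 1) ∷ [])

alt : Bool → List ℕ → List Bool
alt x [] = []
alt true (k ∷ ks) = replicate k true ++ alt false ks
alt false (k ∷ ks) = replicate k false ++ alt true ks

pqAux : ℕ → ℕ → ℕ → List ℕ
pqAux zero a b = []
pqAux (suc f) a zero = []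
pqAux (suc f) a (suc b) = (a / suc b) ∷ pqAux f (suc b) (a % suc b)

-- Partial quotients r₀,…,r_{t-1} of a generated by b (fuel b+1 suffices since
-- the second argument strictly decreases).
partialQuotients : ℕ → ℕ → List ℕ
partialQuotients a b = pqAux (suc b) a b

decLast : List ℕ → List ℕ
decLast [] = []
decLast (x ∷ []) = (x ∸ 1) ∷ []
decLast (x ∷ y ∷ ys) = x ∷ decLast (y ∷ ys)

euclideanDesign : ℕ → ℕ → List Bool
euclideanDesign a b =
  if (a ≡ᵇ 1) Data.Bool.∧ (b ≡ᵇ 1)
  then true ∷ []
  else (if length rs % 2 ≡ᵇ 1
        then alt true rs
        else alt true (decLast rs) ++ (true ∷ []))
  where rs = partialQuotients a b

mergeLast : List ℕ → List ℕ
mergeLast [] = []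
mergeLast (x ∷ []) = x ∷ []
mergeLast (x ∷ y ∷ []) = suc x ∷ []
mergeLast (x ∷ y ∷ z ∷ zs) = x ∷ mergeLast (y ∷ z ∷ zs)

{-# OPTIONS --safe #-}
-- Reading a word w letter by letter, the pair ([2^k : v], [2^k : v + 1]) at the value v of the
-- prefix read so far is transformed by (x, y) ↦ (x + y, y) on a letter 1 and by (x, y) ↦ (x, x + y)
-- on a letter 0, starting from (0, 1); the complementary word has value 2^n - 1 - v, and it runs
-- the same moves with the coordinates swapped.  On a word 1^{r₀} 0^{r₁} ⋯ 1^{r_{t-1}} with an odd
-- number of blocks these moves compose to the continuant recursion of the realizing pair of
-- r₀, …, r_{t-1}; an even sequence of partial quotients is first rewritten as
-- r₀, …, r_{t-1} - 1, 1, which has the same realizing pair.  For (2), a design ending in 11 has a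
-- last block of length ≥ 2, and one ending in 01 has a last block of length 1, which after merging
-- it into the previous block is exactly the condition for a valid sequence of partial quotients.

module Submission where

open import Defs
open import Data.Nat using (ℕ; NonZero; zero; suc; _+_; _*_; _∸_; _^_; _≤_; _<_; z≤n; s≤s; _≡ᵇ_)
open import Data.Nat.Properties
open import Data.Nat.DivMod
open import Data.Nat.Tactic.RingSolver using (solve-∀)
open import Data.Bool using (Bool; true; false; not; if_then_else_)
open import Data.List using (List; []; _∷_; initLast; _∷ʳ′_; _++_; _∷ʳ_; length; replicate; map; foldl)
open import Data.List.Properties using (++-assoc; ++-identityʳ; foldl-++; length-map; ∷ʳ-injectiveˡ; ∷ʳ-injectiveʳ)
open import Data.List.Relation.Unary.All.Properties using (∷ʳ⁻)
open import Data.Empty using (⊥-elim)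
open import Relation.Nullary using (¬_)
open import Data.Product using (_×_; _,_; proj₁; proj₂; swap; ∃₂; ∃-syntax)
open import Data.List.Relation.Unary.All using (All; []; _∷_)
open import Data.Nat.Coprimality using (Coprime)
open import Data.Nat.Divisibility using (_∣_; m∣m*n; n∣m*n; ∣-refl; ∣m∣n⇒∣m+n; ∣n⇒∣m*n; ∣m+n∣m⇒∣n; ∣1⇒≡1; m%n≡0⇒n∣m)
open import Data.Bool.Properties using (not-involutive)
open import Relation.Binary.PropositionalEquality using (_≡_; refl; sym; trans; cong; cong₂; subst; module ≡-Reasoning)
open import Function using (_∘_)
open ≡-Reasoning

-- Stern's diatomic integers along a binary word

step : ℕ → Bool → ℕ
step v d = 2 * v + (if d then 1 else 0)

step-%2 : ∀ v d → step v d % 2 ≡ (if d then 1 else 0)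
step-%2 v false = %-remove-+ˡ 0 (m∣m*n v)
step-%2 v true = %-remove-+ˡ 1 (m∣m*n v)

step-/2 : ∀ v d → step v d / 2 ≡ v
step-/2 v d = begin
  (2 * v + (if d then 1 else 0)) / 2       ≡⟨ +-distrib-/-∣ˡ (if d then 1 else 0) (m∣m*n v) ⟩
  2 * v / 2 + (if d then 1 else 0) / 2     ≡⟨ cong₂ _+_ (trans (/-congˡ (*-comm 2 v)) (m*n/n≡m v 2)) (bit/2 d) ⟩
  v + 0                                    ≡⟨ +-identityʳ v ⟩
  v                                        ∎
  where
  bit/2 : ∀ d → (if d then 1 else 0) / 2 ≡ 0
  bit/2 false = refl
  bit/2 true = refl

stern-even : ∀ n v → stern (suc n) (step v false) ≡ stern n v
stern-even n v rewrite step-%2 v false | step-/2 v false = refl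

stern-odd : ∀ n v → stern (suc n) (step v true) ≡ stern n v + stern n (suc v)
stern-odd n v rewrite step-%2 v true | step-/2 v true = refl

mediant : ℕ × ℕ → Bool → ℕ × ℕ
mediant (x , y) true = (x + y , y)
mediant (x , y) false = (x , x + y)

act : List Bool → ℕ × ℕ → ℕ × ℕ
act w p = foldl mediant p w

sternPair : ℕ → ℕ → ℕ × ℕ
sternPair n v = (stern n v , stern n (suc v))

sternPair-step : ∀ n v d → sternPair (suc n) (step v d) ≡ mediant (sternPair n v) d
sternPair-step n v false =
  cong₂ _,_ (stern-even n v) (trans (cong (stern (suc n)) (suc-even v)) (stern-odd n v))
  where
  suc-even : ∀ v → suc (2 * v + 0) ≡ 2 * v + 1
  suc-even = solve-∀
sternPair-step n v true =
  cong₂ _,_ (stern-odd n v) (trans (cong (stern (suc n)) (suc-odd v)) (stern-even n (suc v)))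
  where
  suc-odd : ∀ v → suc (2 * v + 1) ≡ 2 * suc v + 0
  suc-odd = solve-∀

sternPair-foldl : ∀ n v w → sternPair (n + length w) (foldl step v w) ≡ act w (sternPair n v)
sternPair-foldl n v [] = cong (λ k → sternPair k v) (+-identityʳ n)
sternPair-foldl n v (d ∷ w) = begin
  sternPair (n + suc (length w)) (foldl step (step v d) w)  ≡⟨ cong (λ k → sternPair k (foldl step (step v d) w)) (+-suc n (length w)) ⟩
  sternPair (suc n + length w) (foldl step (step v d) w)    ≡⟨ sternPair-foldl (suc n) (step v d) w ⟩
  act w (sternPair (suc n) (step v d))                      ≡⟨ cong (act w) (sternPair-step n v d) ⟩
  act w (mediant (sternPair n v) d)                         ∎

stern-val : ∀ w → stern (length w) (val w) ≡ proj₁ (act w (0 , 1))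
stern-val w = cong proj₁ (sternPair-foldl 0 0 w)

foldl-step-complement : ∀ w v v′ →
  foldl step v w + foldl step v′ (map not w) + 1 ≡ (v + v′ + 1) * 2 ^ length w
foldl-step-complement [] v v′ = sym (*-identityʳ _)
foldl-step-complement (true ∷ w) v v′ =
  trans (foldl-step-complement w (step v true) (step v′ false)) (double v v′ (2 ^ length w))
  where
  double : ∀ v v′ p → (2 * v + 1 + (2 * v′ + 0) + 1) * p ≡ (v + v′ + 1) * (2 * p)
  double = solve-∀
foldl-step-complement (false ∷ w) v v′ =
  trans (foldl-step-complement w (step v false) (step v′ true)) (double v v′ (2 ^ length w))
  where
  double : ∀ v v′ p → (2 * v + 0 + (2 * v′ + 1) + 1) * p ≡ (v + v′ + 1) * (2 * p)
  double = solve-∀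

val-complement : ∀ w → 2 ^ length w ∸ val w ≡ suc (val (map not w))
val-complement w = begin
  2 ^ length w ∸ val w                              ≡⟨ cong (_∸ val w) (sym sum) ⟩
  val w + suc (val (map not w)) ∸ val w              ≡⟨ m+n∸m≡n (val w) _ ⟩
  suc (val (map not w))                              ∎
  where
  sum : val w + suc (val (map not w)) ≡ 2 ^ length w
  sum = begin
    val w + suc (val (map not w))        ≡⟨ +-suc (val w) _ ⟩
    suc (val w + val (map not w))        ≡⟨ +-comm 1 _ ⟩
    val w + val (map not w) + 1          ≡⟨ foldl-step-complement w 0 0 ⟩
    1 * 2 ^ length w                     ≡⟨ *-identityˡ _ ⟩
    2 ^ length w                         ∎

act-map-not : ∀ w x y → act (map not w) (x , y) ≡ swap (act w (y , x))
act-map-not [] x y = refl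
act-map-not (true ∷ w) x y rewrite act-map-not w x (x + y) | +-comm x y = refl
act-map-not (false ∷ w) x y rewrite act-map-not w (x + y) y | +-comm x y = refl

stern-complement : ∀ w → stern (length w) (2 ^ length w ∸ val w) ≡ proj₁ (act w (1 , 0))
stern-complement w = begin
  stern (length w) (2 ^ length w ∸ val w)              ≡⟨ cong (stern (length w)) (val-complement w) ⟩
  stern (length w) (suc (val (map not w)))             ≡⟨ cong (λ k → stern k (suc (val (map not w)))) (sym (length-map not w)) ⟩
  stern (length (map not w)) (suc (val (map not w)))   ≡⟨ cong proj₂ (sternPair-foldl 0 0 (map not w)) ⟩
  proj₂ (act (map not w) (0 , 1))                      ≡⟨ cong proj₂ (act-map-not w 0 1) ⟩
  proj₁ (act w (1 , 0))                                ∎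

-- Realizing pairs and the Euclidean algorithm

-- a / b = r₀ + 1 / (r₁ + 1 / (⋯ + 1 / r_{t-1})), the realizing pair of r₀, …, r_{t-1}
realizingPair : List ℕ → ℕ × ℕ
realizingPair [] = (1 , 0)
realizingPair (r ∷ rs) = (r * proj₁ (realizingPair rs) + proj₂ (realizingPair rs) , proj₁ (realizingPair rs))

realizingPair-coprime : ∀ rs {a b} → realizingPair rs ≡ (a , b) → Coprime a b
realizingPair-coprime [] refl (d∣1 , _) = ∣1⇒≡1 d∣1
realizingPair-coprime (r ∷ rs) refl (d∣a , d∣b) =
  realizingPair-coprime rs refl (d∣b , ∣m+n∣m⇒∣n d∣a (∣n⇒∣m*n r d∣b))

realizingPair-∷ʳ-1 : ∀ xs j → realizingPair (xs ∷ʳ j ∷ʳ 1) ≡ realizingPair (xs ∷ʳ suc j)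
realizingPair-∷ʳ-1 [] j = cong (_, 1) (last j)
  where
  last : ∀ j → j * (1 * 1 + 0) + 1 ≡ suc j * 1 + 0
  last = solve-∀
realizingPair-∷ʳ-1 (x ∷ xs) j =
  cong (λ p → (x * proj₁ p + proj₂ p , proj₁ p)) (realizingPair-∷ʳ-1 xs j)

pqAux-fuel : ∀ f g a b → b < f → b < g → pqAux f a b ≡ pqAux g a b
pqAux-fuel (suc f) (suc g) a zero _ _ = refl
pqAux-fuel (suc f) (suc g) a (suc b) (s≤s b<f) (s≤s b<g) =
  cong (a / suc b ∷_) (pqAux-fuel f g (suc b) (a % suc b) (≤-trans r<b b<f) (≤-trans r<b b<g))
  where
  r<b : a % suc b < suc b
  r<b = m%n<n a (suc b)

partialQuotients-step : ∀ r {a b} → b < a → partialQuotients (r * a + b) a ≡ r ∷ partialQuotients a b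
partialQuotients-step r {suc a} {b} b<a =
  cong₂ _∷_ quotient (trans (cong (pqAux (suc a) (suc a)) remainder) (pqAux-fuel (suc a) (suc b) (suc a) b b<a (n<1+n b)))
  where
  quotient : (r * suc a + b) / suc a ≡ r
  quotient = begin
    (r * suc a + b) / suc a           ≡⟨ +-distrib-/-∣ˡ b (n∣m*n r) ⟩
    r * suc a / suc a + b / suc a     ≡⟨ cong₂ _+_ (m*n/n≡m r (suc a)) (m<n⇒m/n≡0 b<a) ⟩
    r + 0                             ≡⟨ +-identityʳ r ⟩
    r                                 ∎
  remainder : (r * suc a + b) % suc a ≡ b
  remainder = trans (%-remove-+ˡ b (n∣m*n r)) (m<n⇒m%n≡m b<a)

realizingPair-single : ∀ q → realizingPair (q ∷ []) ≡ (q , 1)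
realizingPair-single q = cong (_, 1) (trans (+-identityʳ (q * 1)) (*-identityʳ q))

pqAux-zero : ∀ f a → pqAux f a 0 ≡ []
pqAux-zero zero a = refl
pqAux-zero (suc f) a = refl

m%n≡r⇒m≡r+m/n*n : ∀ a b .{{_ : NonZero b}} {r} → a % b ≡ r → a ≡ r + a / b * b
m%n≡r⇒m≡r+m/n*n a b {r} rem = trans (m≡m%n+[m/n]*n a b) (cong (_+ a / b * b) rem)

coprime-remainder : ∀ a b .{{_ : NonZero b}} {r} → a ≡ r + a / b * b → Coprime a b → Coprime b r
coprime-remainder a b a≡ cop (d∣b , d∣r) =
  cop (subst (_ ∣_) (sym a≡) (∣m∣n⇒∣m+n d∣r (∣n⇒∣m*n (a / b) d∣b)) , d∣b)

pqAux-realizingPair : ∀ f a b → b < f → 0 < a → 0 < b → Coprime a b →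
  realizingPair (pqAux f a b) ≡ (a , b) × ∃₂ λ xs j → pqAux f a b ≡ xs ∷ʳ suc j
pqAux-realizingPair (suc f) (suc a) (suc b) (s≤s b<f) _ _ cop with suc a % suc b in rem
... | zero with cop (m%n≡0⇒n∣m (suc a) (suc b) rem , ∣-refl)
...   | refl rewrite pqAux-zero f 1 | n/1≡n (suc a) = realizingPair-single (suc a) , [] , a , refl
pqAux-realizingPair (suc f) (suc a) (suc b) (s≤s b<f) _ _ cop | suc r
  with pqAux-realizingPair f (suc b) (suc r) (≤-trans (subst (_< suc b) rem (m%n<n (suc a) (suc b))) b<f)
         (s≤s z≤n) (s≤s z≤n) (coprime-remainder (suc a) (suc b) (m%n≡r⇒m≡r+m/n*n (suc a) (suc b) rem) cop)
... | pair≡ , xs , j , quotients≡ rewrite pair≡ =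
  cong (_, suc b) (sym (trans (m%n≡r⇒m≡r+m/n*n (suc a) (suc b) rem) (+-comm (suc r) _))) ,
  suc a / suc b ∷ xs , j , cong (suc a / suc b ∷_) quotients≡

partialQuotients-realizingPair : ∀ {a b} → 0 < a → 0 < b → Coprime a b →
  realizingPair (partialQuotients a b) ≡ (a , b) × ∃₂ λ xs j → partialQuotients a b ≡ xs ∷ʳ suc j
partialQuotients-realizingPair {a} {b} = pqAux-realizingPair (suc b) a b (n<1+n b)

-- the letter of the block that alt c would append after the blocks ks
nextColour : Bool → List ℕ → Bool
nextColour c [] = c
nextColour c (_ ∷ ks) = nextColour (not c) ks

nextColour-parity : ∀ ks → nextColour true ks ≡ not (length ks % 2 ≡ᵇ 1)
nextColour-parity [] = refl
nextColour-parity (_ ∷ []) = refl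
nextColour-parity (_ ∷ _ ∷ ks) = nextColour-parity ks

nextColour-∷ʳ : ∀ c ks k → nextColour c (ks ∷ʳ k) ≡ not (nextColour c ks)
nextColour-∷ʳ c [] k = refl
nextColour-∷ʳ c (_ ∷ ks) k = nextColour-∷ʳ (not c) ks k

nextColour-∷ʳ-∷ʳ : ∀ c ks j k → nextColour c (ks ∷ʳ j ∷ʳ k) ≡ nextColour c ks
nextColour-∷ʳ-∷ʳ c ks j k = begin
  nextColour c (ks ∷ʳ j ∷ʳ k)        ≡⟨ nextColour-∷ʳ c (ks ∷ʳ j) k ⟩
  not (nextColour c (ks ∷ʳ j))       ≡⟨ cong not (nextColour-∷ʳ c ks j) ⟩
  not (not (nextColour c ks))        ≡⟨ not-involutive _ ⟩
  nextColour c ks                    ∎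

nextColour-decLast : ∀ c ks → nextColour c (decLast ks) ≡ nextColour c ks
nextColour-decLast c [] = refl
nextColour-decLast c (_ ∷ []) = refl
nextColour-decLast c (_ ∷ k ∷ ks) = nextColour-decLast (not c) (k ∷ ks)

alt-∷ʳ : ∀ c ks k → alt c (ks ∷ʳ k) ≡ alt c ks ++ replicate k (nextColour c ks)
alt-∷ʳ true [] k = ++-identityʳ (replicate k true)
alt-∷ʳ false [] k = ++-identityʳ (replicate k false)
alt-∷ʳ true (k′ ∷ ks) k =
  trans (cong (replicate k′ true ++_) (alt-∷ʳ false ks k)) (sym (++-assoc (replicate k′ true) _ _))
alt-∷ʳ false (k′ ∷ ks) k =
  trans (cong (replicate k′ false ++_) (alt-∷ʳ true ks k)) (sym (++-assoc (replicate k′ false) _ _))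

decLast-∷ʳ : ∀ ks k → decLast (ks ∷ʳ k) ≡ ks ∷ʳ (k ∸ 1)
decLast-∷ʳ [] k = refl
decLast-∷ʳ (k′ ∷ []) k = refl
decLast-∷ʳ (k′ ∷ k″ ∷ ks) k = cong (k′ ∷_) (decLast-∷ʳ (k″ ∷ ks) k)

mergeLast-∷ʳ : ∀ ks j k → mergeLast (ks ∷ʳ j ∷ʳ k) ≡ ks ∷ʳ suc j
mergeLast-∷ʳ [] j k = refl
mergeLast-∷ʳ (k′ ∷ []) j k = refl
mergeLast-∷ʳ (k′ ∷ k″ ∷ []) j k = cong (k′ ∷_) (mergeLast-∷ʳ (k″ ∷ []) j k)
mergeLast-∷ʳ (k′ ∷ k″ ∷ k‴ ∷ ks) j k = cong (k′ ∷_) (mergeLast-∷ʳ (k″ ∷ k‴ ∷ ks) j k)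

-- [r₀, …, r_{t-2}, r_{t-1}] of even length becomes [r₀, …, r_{t-2}, r_{t-1} - 1, 1]
oddExpansion : List ℕ → List ℕ
oddExpansion rs = if nextColour true rs then decLast rs ∷ʳ 1 else rs

design-oddExpansion : ∀ rs →
  (if length rs % 2 ≡ᵇ 1 then alt true rs else alt true (decLast rs) ++ true ∷ []) ≡ alt true (oddExpansion rs)
design-oddExpansion rs with length rs % 2 ≡ᵇ 1 in parity
... | true rewrite nextColour-parity rs | parity = refl
... | false = begin
  alt true (decLast rs) ++ true ∷ []                                   ≡⟨ cong (λ c → alt true (decLast rs) ++ c ∷ []) (sym colour) ⟩
  alt true (decLast rs) ++ replicate 1 (nextColour true (decLast rs))  ≡⟨ sym (alt-∷ʳ true (decLast rs) 1) ⟩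
  alt true (decLast rs ∷ʳ 1)                                          ≡⟨ cong (λ c → alt true (if c then decLast rs ∷ʳ 1 else rs)) (sym even) ⟩
  alt true (oddExpansion rs)                                          ∎
  where
  even : nextColour true rs ≡ true
  even = trans (nextColour-parity rs) (cong not parity)
  colour : nextColour true (decLast rs) ≡ true
  colour = trans (nextColour-decLast true rs) even

-- the special clause for (a, b) = (1, 1) agrees with the general one, since partialQuotients 1 1 = [1]
euclideanDesign-oddExpansion : ∀ a b → euclideanDesign a b ≡ alt true (oddExpansion (partialQuotients a b))
euclideanDesign-oddExpansion 1 1 = refl
euclideanDesign-oddExpansion 0 b = design-oddExpansion (partialQuotients 0 b)
euclideanDesign-oddExpansion 1 0 = design-oddExpansion (partialQuotients 1 0)
euclideanDesign-oddExpansion 1 (suc (suc b)) = design-oddExpansion (partialQuotients 1 (suc (suc b)))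
euclideanDesign-oddExpansion (suc (suc a)) b = design-oddExpansion (partialQuotients (suc (suc a)) b)

-- Evaluating a design

act-ones : ∀ k x y → act (replicate k true) (x , y) ≡ (x + k * y , y)
act-ones zero x y = cong (_, y) (sym (+-identityʳ x))
act-ones (suc k) x y = trans (act-ones k (x + y) y) (cong (_, y) (+-assoc x y (k * y)))

act-zeros : ∀ k x y → act (replicate k false) (x , y) ≡ (x , y + k * x)
act-zeros zero x y = cong (x ,_) (sym (+-identityʳ y))
act-zeros (suc k) x y =
  trans (act-zeros k x (x + y)) (cong (x ,_) (trans (cong (_+ k * x) (+-comm x y)) (+-assoc y x (k * x))))

act-alt : ∀ rs x y → nextColour true rs ≡ false →
  proj₁ (act (alt true rs) (x , y)) ≡ x * proj₂ (realizingPair rs) + y * proj₁ (realizingPair rs)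
act-alt (r ∷ []) x y _ = begin
  proj₁ (act (replicate r true ++ []) (x , y))   ≡⟨ cong (λ w → proj₁ (act w (x , y))) (++-identityʳ (replicate r true)) ⟩
  proj₁ (act (replicate r true) (x , y))         ≡⟨ cong proj₁ (act-ones r x y) ⟩
  x + r * y                                      ≡⟨ single x y r ⟩
  x * 1 + y * (r * 1 + 0)                        ∎
  where
  single : ∀ x y r → x + r * y ≡ x * 1 + y * (r * 1 + 0)
  single = solve-∀
act-alt (r₀ ∷ r₁ ∷ rs) x y odd = begin
  proj₁ (act (replicate r₀ true ++ replicate r₁ false ++ alt true rs) (x , y))
    ≡⟨ cong proj₁ blocks ⟩
  proj₁ (act (alt true rs) (x + r₀ * y , y + r₁ * (x + r₀ * y)))
    ≡⟨ act-alt rs (x + r₀ * y) (y + r₁ * (x + r₀ * y)) odd ⟩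
  (x + r₀ * y) * b + (y + r₁ * (x + r₀ * y)) * a
    ≡⟨ continuant x y r₀ r₁ a b ⟩
  x * (r₁ * a + b) + y * (r₀ * (r₁ * a + b) + a)
    ∎
  where
  a b : ℕ
  a = proj₁ (realizingPair rs)
  b = proj₂ (realizingPair rs)
  continuant : ∀ x y r₀ r₁ a b → (x + r₀ * y) * b + (y + r₁ * (x + r₀ * y)) * a
                                 ≡ x * (r₁ * a + b) + y * (r₀ * (r₁ * a + b) + a)
  continuant = solve-∀
  blocks : act (replicate r₀ true ++ replicate r₁ false ++ alt true rs) (x , y)
         ≡ act (alt true rs) (x + r₀ * y , y + r₁ * (x + r₀ * y))
  blocks = begin
    act (replicate r₀ true ++ replicate r₁ false ++ alt true rs) (x , y)
      ≡⟨ foldl-++ mediant (x , y) (replicate r₀ true) _ ⟩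
    act (replicate r₁ false ++ alt true rs) (act (replicate r₀ true) (x , y))
      ≡⟨ cong (act (replicate r₁ false ++ alt true rs)) (act-ones r₀ x y) ⟩
    act (replicate r₁ false ++ alt true rs) (x + r₀ * y , y)
      ≡⟨ foldl-++ mediant (x + r₀ * y , y) (replicate r₁ false) _ ⟩
    act (alt true rs) (act (replicate r₁ false) (x + r₀ * y , y))
      ≡⟨ cong (act (alt true rs)) (act-zeros r₁ (x + r₀ * y) y) ⟩
    act (alt true rs) (x + r₀ * y , y + r₁ * (x + r₀ * y))
      ∎

nextColour-oddExpansion : ∀ xs j → nextColour true (oddExpansion (xs ∷ʳ suc j)) ≡ false
nextColour-oddExpansion xs j with nextColour true (xs ∷ʳ suc j) in colour
... | false = colour
... | true = trans (nextColour-∷ʳ true (decLast (xs ∷ʳ suc j)) 1) (cong not (trans (nextColour-decLast true (xs ∷ʳ suc j)) colour))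

oddExpansion-realizingPair : ∀ xs j → realizingPair (oddExpansion (xs ∷ʳ suc j)) ≡ realizingPair (xs ∷ʳ suc j)
oddExpansion-realizingPair xs j with nextColour true (xs ∷ʳ suc j)
... | false = refl
... | true rewrite decLast-∷ʳ xs (suc j) = realizingPair-∷ʳ-1 xs j

euclideanDesign-act : ∀ {a b} → 0 < a → 0 < b → Coprime a b →
  ∀ x y → proj₁ (act (euclideanDesign a b) (x , y)) ≡ x * b + y * a
euclideanDesign-act {a} {b} 0<a 0<b cop x y with partialQuotients-realizingPair 0<a 0<b cop
... | pair≡ , xs , j , quotients≡ = begin
  proj₁ (act (euclideanDesign a b) (x , y))
    ≡⟨ cong (λ w → proj₁ (act w (x , y))) (trans (euclideanDesign-oddExpansion a b) (cong (alt true ∘ oddExpansion) quotients≡)) ⟩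
  proj₁ (act (alt true (oddExpansion (xs ∷ʳ suc j))) (x , y))
    ≡⟨ act-alt (oddExpansion (xs ∷ʳ suc j)) x y (nextColour-oddExpansion xs j) ⟩
  x * proj₂ (realizingPair (oddExpansion (xs ∷ʳ suc j))) + y * proj₁ (realizingPair (oddExpansion (xs ∷ʳ suc j)))
    ≡⟨ cong (λ p → x * proj₂ p + y * proj₁ p) (trans (oddExpansion-realizingPair xs j) (trans (cong realizingPair (sym quotients≡)) pair≡)) ⟩
  x * b + y * a
    ∎

stern-euclideanDesign : ∀ {a b} → 0 < a → 0 < b → Coprime a b →
  let w = euclideanDesign a b in a ≡ stern (length w) (val w) × b ≡ stern (length w) (2 ^ length w ∸ val w)
stern-euclideanDesign {a} {b} 0<a 0<b cop =
  sym (trans (stern-val w) (trans (euclideanDesign-act 0<a 0<b cop 0 1) (+-identityʳ a))) ,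
  sym (trans (stern-complement w) (trans (euclideanDesign-act 0<a 0<b cop 1 0) (trans (+-identityʳ (b + 0)) (+-identityʳ b))))
  where
  w : List Bool
  w = euclideanDesign a b

-- Realizable sequences of partial quotients

data QuotientTail : List ℕ → Set where
  [_] : ∀ {r} → 2 ≤ r → QuotientTail (r ∷ [])
  _∷_ : ∀ {r rs} → 1 ≤ r → QuotientTail rs → QuotientTail (r ∷ rs)

data QuotientSeq : List ℕ → Set where
  [_] : ∀ {r} → 2 ≤ r → QuotientSeq (r ∷ [])
  _∷_ : ∀ r₀ {rs} → QuotientTail rs → QuotientSeq (r₀ ∷ rs)

quotientTail-∷ʳ : ∀ {ks k} → All (1 ≤_) ks → 2 ≤ k → QuotientTail (ks ∷ʳ k)
quotientTail-∷ʳ [] 2≤k = [ 2≤k ]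
quotientTail-∷ʳ (1≤k′ ∷ pos) 2≤k = 1≤k′ ∷ quotientTail-∷ʳ pos 2≤k

quotientTail-realizes : ∀ {rs a b} → QuotientTail rs → realizingPair rs ≡ (a , b) →
  b < a × 0 < b × partialQuotients a b ≡ rs
quotientTail-realizes {r ∷ []} [ 2≤r ] pair≡ with trans (sym (realizingPair-single r)) pair≡
... | refl = 2≤r , s≤s z≤n , cong₂ _∷_ (n/1≡n r) (cong (pqAux 1 1) (n%1≡0 r))
quotientTail-realizes (_∷_ {suc r} {rs} _ t) refl with quotientTail-realizes t refl
... | b<a , 0<b , quotients≡ =
  ≤-<-trans (m≤m+n a (r * a)) (m<m+n (a + r * a) 0<b) ,
  ≤-trans 0<b (<⇒≤ b<a) ,
  trans (partialQuotients-step (suc r) b<a) (cong (suc r ∷_) quotients≡)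
  where
  a : ℕ
  a = proj₁ (realizingPair rs)

quotientSeq-realizes : ∀ {rs a b} → QuotientSeq rs → realizingPair rs ≡ (a , b) →
  0 < a × 0 < b × partialQuotients a b ≡ rs
quotientSeq-realizes [ 2≤r ] pair≡ with quotientTail-realizes [ 2≤r ] pair≡
... | b<a , 0<b , quotients≡ = ≤-trans 0<b (<⇒≤ b<a) , 0<b , quotients≡
quotientSeq-realizes (r₀ ∷ t) refl with quotientTail-realizes t refl
... | b<a , 0<b , quotients≡ =
  ≤-trans 0<b (m≤n+m _ (r₀ * _)) , ≤-trans 0<b (<⇒≤ b<a) ,
  trans (partialQuotients-step r₀ b<a) (cong (r₀ ∷_) quotients≡)

realization : ∀ {rs} (w : List Bool) → QuotientSeq rs → alt true (oddExpansion rs) ≡ w →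
  ∃[ a ] ∃[ b ] (0 < a × 0 < b × Coprime a b × partialQuotients a b ≡ rs × euclideanDesign a b ≡ w)
realization {rs} w q design with realizingPair rs in pair≡
... | a , b with quotientSeq-realizes q pair≡
... | 0<a , 0<b , quotients≡ =
  a , b , 0<a , 0<b , realizingPair-coprime rs pair≡ , quotients≡ ,
  trans (euclideanDesign-oddExpansion a b) (trans (cong (alt true ∘ oddExpansion) quotients≡) design)

-- The last two letters of an odd design

oddExpansion-of-odd : ∀ {rs} → nextColour true rs ≡ false → oddExpansion rs ≡ rs
oddExpansion-of-odd odd rewrite odd = refl

oddExpansion-mergeLast : ∀ xs j → nextColour true xs ≡ false → oddExpansion (mergeLast (xs ∷ʳ j ∷ʳ 1)) ≡ xs ∷ʳ j ∷ʳ 1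
oddExpansion-mergeLast xs j odd
  rewrite mergeLast-∷ʳ xs j 1 | nextColour-∷ʳ true xs (suc j) | odd | decLast-∷ʳ xs (suc j) = refl

odd⇒nextColour-false : ∀ ks → length ks % 2 ≡ 1 → nextColour true ks ≡ false
odd⇒nextColour-false ks odd = trans (nextColour-parity ks) (cong (λ p → not (p ≡ᵇ 1)) odd)

alt-∷ʳ-∷ʳ : ∀ xs j k → nextColour true xs ≡ false →
  alt true (xs ∷ʳ j ∷ʳ k) ≡ (alt true xs ++ replicate j false) ++ replicate k true
alt-∷ʳ-∷ʳ xs j k odd = begin
  alt true (xs ∷ʳ j ∷ʳ k)
    ≡⟨ alt-∷ʳ true (xs ∷ʳ j) k ⟩
  alt true (xs ∷ʳ j) ++ replicate k (nextColour true (xs ∷ʳ j))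
    ≡⟨ cong₂ (λ w c → w ++ replicate k c) (alt-∷ʳ true xs j) (trans (nextColour-∷ʳ true xs j) (cong not odd)) ⟩
  (alt true xs ++ replicate j (nextColour true xs)) ++ replicate k true
    ≡⟨ cong (λ c → (alt true xs ++ replicate j c) ++ replicate k true) odd ⟩
  (alt true xs ++ replicate j false) ++ replicate k true
    ∎

data OddBlocks (k₀ : ℕ) : List ℕ → Set where
  []    : OddBlocks k₀ []
  block : ∀ zs j k → nextColour true (k₀ ∷ zs) ≡ false → OddBlocks k₀ (zs ∷ʳ j ∷ʳ k)

oddBlocks : ∀ k₀ ks → nextColour true (k₀ ∷ ks) ≡ false → OddBlocks k₀ ks
oddBlocks k₀ ks odd with initLast ks
oddBlocks k₀ .[] odd | [] = []
oddBlocks k₀ .(ys ∷ʳ k) odd | ys ∷ʳ′ k with initLast ys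
oddBlocks k₀ .([] ∷ʳ k) () | .[] ∷ʳ′ k | []
oddBlocks k₀ .(zs ∷ʳ j ∷ʳ k) odd | .(zs ∷ʳ j) ∷ʳ′ k | zs ∷ʳ′ j =
  block zs j k (trans (sym (nextColour-∷ʳ-∷ʳ true (k₀ ∷ zs) j k)) odd)

EndsWith : Bool → List Bool → Set
EndsWith c w = ∃[ u ] w ≡ u ∷ʳ c

endsWith-unique : ∀ {b c w} → EndsWith b w → EndsWith c w → b ≡ c
endsWith-unique (u , refl) (v , eq) = ∷ʳ-injectiveʳ u v eq

¬endsWith-[] : ∀ {c} → ¬ EndsWith c []
¬endsWith-[] ([] , ())
¬endsWith-[] (_ ∷ _ , ())

++-replicate-suc : ∀ w k (c : Bool) → w ++ replicate (suc k) c ≡ (w ++ replicate k c) ∷ʳ c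
++-replicate-suc w zero c = cong (_∷ʳ c) (sym (++-identityʳ w))
++-replicate-suc w (suc k) c = begin
  w ++ c ∷ replicate (suc k) c          ≡⟨ sym (++-assoc w (c ∷ []) (replicate (suc k) c)) ⟩
  (w ∷ʳ c) ++ replicate (suc k) c       ≡⟨ ++-replicate-suc (w ∷ʳ c) k c ⟩
  ((w ∷ʳ c) ++ replicate k c) ∷ʳ c      ≡⟨ cong (_∷ʳ c) (++-assoc w (c ∷ []) (replicate k c)) ⟩
  (w ++ replicate (suc k) c) ∷ʳ c       ∎

endsWith-replicate : ∀ w {k c} → 1 ≤ k → EndsWith c (w ++ replicate k c)
endsWith-replicate w {suc k} {c} _ = w ++ replicate k c , ++-replicate-suc w k c

zeros-¬endsWith-true : ∀ w {k} → 1 ≤ k → ¬ EndsWith true (w ++ replicate k false)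
zeros-¬endsWith-true w 1≤k e with endsWith-unique e (endsWith-replicate w 1≤k)
... | ()

lastRun-11 : ∀ w k u → ¬ EndsWith true w → w ++ replicate k true ≡ (u ∷ʳ true) ∷ʳ true → 2 ≤ k
lastRun-11 w zero u ¬end eq = ⊥-elim (¬end (u ∷ʳ true , trans (sym (++-identityʳ w)) eq))
lastRun-11 w (suc zero) u ¬end eq = ⊥-elim (¬end (u , ∷ʳ-injectiveˡ w (u ∷ʳ true) eq))
lastRun-11 w (suc (suc k)) u _ _ = s≤s (s≤s z≤n)

lastRun-01 : ∀ w k u → ¬ EndsWith true w → w ++ replicate k true ≡ (u ∷ʳ false) ∷ʳ true →
  k ≡ 1 × EndsWith false w
lastRun-01 w zero u ¬end eq = ⊥-elim (¬end (u ∷ʳ false , trans (sym (++-identityʳ w)) eq))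
lastRun-01 w (suc zero) u _ eq = refl , u , ∷ʳ-injectiveˡ w (u ∷ʳ false) eq
lastRun-01 w (suc (suc k)) u _ eq
  with endsWith-unique (endsWith-replicate w (s≤s z≤n))
         (u , ∷ʳ-injectiveˡ _ (u ∷ʳ false) (trans (sym (++-replicate-suc w (suc k) true)) eq))
... | ()

design-11⇒quotientSeq : ∀ k₀ ks u → nextColour true (k₀ ∷ ks) ≡ false → All (1 ≤_) ks →
  alt true (k₀ ∷ ks) ≡ (u ∷ʳ true) ∷ʳ true → QuotientSeq (k₀ ∷ ks) × oddExpansion (k₀ ∷ ks) ≡ k₀ ∷ ks
design-11⇒quotientSeq k₀ ks u odd pos ends with oddBlocks k₀ ks odd
... | [] = [ lastRun-11 [] k₀ u ¬endsWith-[] (trans (sym (alt-∷ʳ true [] k₀)) ends) ] , oddExpansion-of-odd odd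
... | block zs j k odd′ with ∷ʳ⁻ pos
...   | pos′ , _ with ∷ʳ⁻ pos′
...     | _ , 1≤j =
  k₀ ∷ quotientTail-∷ʳ pos′ (lastRun-11 _ k u (zeros-¬endsWith-true (alt true (k₀ ∷ zs)) 1≤j)
                                (trans (sym (alt-∷ʳ-∷ʳ (k₀ ∷ zs) j k odd′)) ends)) ,
  oddExpansion-of-odd odd

design-01⇒quotientSeq : ∀ k₀ ks u → nextColour true (k₀ ∷ ks) ≡ false → All (1 ≤_) ks →
  alt true (k₀ ∷ ks) ≡ (u ∷ʳ false) ∷ʳ true →
  QuotientSeq (mergeLast (k₀ ∷ ks)) × oddExpansion (mergeLast (k₀ ∷ ks)) ≡ k₀ ∷ ks
design-01⇒quotientSeq k₀ ks u odd pos ends with oddBlocks k₀ ks odd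
... | [] with lastRun-01 [] k₀ u ¬endsWith-[] (trans (sym (alt-∷ʳ true [] k₀)) ends)
...   | _ , e = ⊥-elim (¬endsWith-[] e)
design-01⇒quotientSeq k₀ ks u odd pos ends | block zs j k odd′ with ∷ʳ⁻ pos
...   | pos′ , _ with ∷ʳ⁻ pos′
...     | pos-zs , 1≤j with lastRun-01 _ k u (zeros-¬endsWith-true (alt true (k₀ ∷ zs)) 1≤j)
                              (trans (sym (alt-∷ʳ-∷ʳ (k₀ ∷ zs) j k odd′)) ends)
...       | refl , _ =
  subst QuotientSeq (sym (mergeLast-∷ʳ (k₀ ∷ zs) j 1)) (k₀ ∷ quotientTail-∷ʳ pos-zs (s≤s 1≤j)) ,
  oddExpansion-mergeLast (k₀ ∷ zs) j odd′

bits-ending : ∀ n m {r} → 1 ≤ n → m % 2 ≡ 1 → 1 ≤ m → m < 2 ^ n → ¬ (m ≡ 1 × n ≡ 1) → m % 4 ≡ r →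
  ∃[ u ] bits n m ≡ (u ∷ʳ (r / 2 ≡ᵇ 1)) ∷ʳ true
bits-ending (suc zero) m _ _ 1≤m (s≤s m≤1) m,n≢1,1 _ = ⊥-elim (m,n≢1,1 (≤-antisym m≤1 1≤m , refl))
bits-ending (suc (suc n)) m {r} _ odd _ _ _ m%4≡r =
  bits n (m / 2 / 2) , cong₂ (λ x y → (bits n (m / 2 / 2) ∷ʳ (x ≡ᵇ 1)) ∷ʳ (y ≡ᵇ 1)) second-last odd
  where
  second-last : m / 2 % 2 ≡ r / 2
  second-last = trans (sym (m%[n*o]/o≡m/o%n m 2 2)) (cong (_/ 2) m%4≡r)

theorem3p8 :
    -- (1)
    (∀ (a b : ℕ) → 0 < a → 0 < b → Coprime a b →
      a ≡ stern (length (euclideanDesign a b)) (val (euclideanDesign a b))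
      × b ≡ stern (length (euclideanDesign a b))
                  (2 ^ length (euclideanDesign a b) ∸ val (euclideanDesign a b))
      × (a ≡ 1 → b ≡ 1 →
           val (euclideanDesign a b) ≡ 1 × length (euclideanDesign a b) ≡ 1))
    ×
    -- (2)
    (∀ (m n : ℕ) → 1 ≤ n → m % 2 ≡ 1 → 1 ≤ m → m < 2 ^ n → ¬ (m ≡ 1 × n ≡ 1) →
      ∀ (k₀ : ℕ) (ks : List ℕ) →
      bits n m ≡ alt true (k₀ ∷ ks) → length (k₀ ∷ ks) % 2 ≡ 1 → All (λ k → 1 ≤ k) ks →
      -- (i)
      (m % 4 ≡ 3 →
        ∃[ a ] ∃[ b ] (0 < a × 0 < b × Coprime a b
          × partialQuotients a b ≡ k₀ ∷ ks × euclideanDesign a b ≡ bits n m))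
      ×
      -- (ii)
      (m % 4 ≡ 1 →
        ∃[ a ] ∃[ b ] (0 < a × 0 < b × Coprime a b
          × partialQuotients a b ≡ mergeLast (k₀ ∷ ks) × euclideanDesign a b ≡ bits n m)))
theorem3p8 =
  (λ a b 0<a 0<b cop →
    let a≡ , b≡ = stern-euclideanDesign 0<a 0<b cop
    in a≡ , b≡ , λ { refl refl → refl , refl }) ,
  λ m n 1≤n m-odd 1≤m m<2ⁿ m,n≢1,1 k₀ ks bits≡ length-odd pos →
    let odd = odd⇒nextColour-false (k₀ ∷ ks) length-odd in
    (λ m%4≡3 →
      let u , ends = bits-ending n m 1≤n m-odd 1≤m m<2ⁿ m,n≢1,1 m%4≡3
          seq , expansion = design-11⇒quotientSeq k₀ ks u odd pos (trans (sym bits≡) ends)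
      in realization (bits n m) seq (trans (cong (alt true) expansion) (sym bits≡))) ,
    (λ m%4≡1 →
      let u , ends = bits-ending n m 1≤n m-odd 1≤m m<2ⁿ m,n≢1,1 m%4≡1
          seq , expansion = design-01⇒quotientSeq k₀ ks u odd pos (trans (sym bits≡) ends)
      in realization (bits n m) seq (trans (cong (alt true) expansion) (sym bits≡)))
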